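{- Let $\mathbb{F}$ be a finite set of features, let $\mathcal{K} \subseteq 2^{\mathbb{F}}$ be a nonempty set of valid configurations, let $\psi \in \mathrm{FeatExp}(\mathbb{F})$, and let $\alpha$ be a variability abstraction (either the join abstraction $\alpha^{\mathrm{join}}$ or a feature ignore abstraction $\alpha^{\mathrm{fignore}}_A$ for some $A \in \mathbb{F}$), with dual $\widetilde{\alpha}$. (i) If $k \in \mathcal{K}$ and $k \models \psi$, then there exists $k' \in \alpha(\mathcal{K})$ such that $k' \models \alpha(\psi)$. (ii) If $k' \in \alpha(\mathcal{K})$ and $k' \models \widetilde{\alpha}(\psi)$, then for all $k \in \mathcal{K}$ with $\alpha(k) = k'$ it holds that $k \models \psi$.
   Context: Features: $\mathbb{F}=\{A_1,\dots,A_n\}$ is a finite set of Boolean variables. $\mathrm{FeatExp}(\mathbb{F})$ is the set of propositional formulae over $\mathbb{F}$ (generated by $\psi ::= \mathit{true} \mid A \in \mathbb{F} \mid \neg\psi \mid \psi_1\wedge\psi_2$, with the usual derived connectives and $\mathit{false}$), considered up to semantic equivalence. A configuration $k \subseteq \mathbb{F}$ is identified with the formula $\bigwedge_{i} k(A_i)$ where $k(A_i)=A_i$ if $A_i\in k$ and $k(A_i)=\neg A_i$ otherwise; $k\models\psi$ means the truth assignment $k$ satisfies $\psi$. A literal of $A$, written $l_A$, is $A$ or $\neg A$; $\psi[l_A\mapsto c]$ denotes the formula obtained from $\psi$, first put in negation normal form, by replacing both literals of $A$ by the constant $c$. Join abstraction: $\alpha^{\mathrm{join}}(\mathbb{F})=\emptyset$,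 $\alpha^{\mathrm{join}}(\mathcal{K})=\{\mathit{true}\}$ (the single configuration over the empty feature set), $\alpha^{\mathrm{join}}(k)=\mathit{true}$ for every configuration $k$; $\alpha^{\mathrm{join}}(\psi)=\mathit{true}$ if some $k\in\mathcal{K}$ satisfies $\psi$ and $\mathit{false}$ otherwise; its dual is $\widetilde{\alpha^{\mathrm{join}}}(\psi)=\mathit{true}$ if every $k\in\mathcal{K}$ satisfies $\psi$ and $\mathit{false}$ otherwise. Feature ignore abstraction for $A\in\mathbb{F}$: $\alpha^{\mathrm{fignore}}_A(\mathbb{F})=\mathbb{F}\setminus\{A\}$, $\alpha^{\mathrm{fignore}}_A(k)=k[l_A\mapsto\mathit{true}]$, $\alpha^{\mathrm{fignore}}_A(\mathcal{K})=\{k[l_A\mapsto\mathit{true}]\mid k\in\mathcal{K}\}$ (abstract configurations over $\mathbb{F}\setminus\{A\}$), $\alpha^{\mathrm{fignore}}_A(\psi)=\psi[l_A\mapsto\mathit{true}]$; its dual is $\widetilde{\alpha^{\mathrm{fignore}}_A}(\psi)=\psi[l_A\mapsto\mathit{false}]$. In general the dual is $\widetilde{\alpha}=\neg\circ\alpha\circ\neg$. -}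

module Defs where

open import Data.Nat using (ℕ; zero; suc)
open import Data.Fin using (Fin; punchOut; _≟_)
open import Data.Bool using (Bool; true; false; not; _∧_; _∨_; if_then_else_)
open import Data.Vec using (Vec; []; lookup; removeAt)
open import Data.List using (List; _∷_; []; map)
open import Data.Bool.ListAction using (any)
open import Relation.Nullary using (yes; no)
open import Relation.Binary.PropositionalEquality using (_≡_)

-- Feature set 𝔽 = {A_1,…,A_n} is represented by Fin n.
-- Feature expressions (syntax; semantics via ⊨).
data FeatExp (n : ℕ) : Set where
  tt   : FeatExp n
  var  : Fin n → FeatExp n
  ¬ᶠ_  : FeatExp n → FeatExp n
  _∧ᶠ_ : FeatExp n → FeatExp n → FeatExp n

ff : ∀ {n} → FeatExp n
ff = ¬ᶠ tt

_∨ᶠ_ : ∀ {n} → FeatExp n → FeatExp n → FeatExp n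
ψ ∨ᶠ φ = ¬ᶠ ((¬ᶠ ψ) ∧ᶠ (¬ᶠ φ))

-- A configuration k ⊆ 𝔽 is its characteristic vector (truth assignment).
Config : ℕ → Set
Config n = Vec Bool n

eval : ∀ {n} → Config n → FeatExp n → Bool
eval k tt        = true
eval k (var A)   = lookup k A
eval k (¬ᶠ ψ)    = not (eval k ψ)
eval k (ψ ∧ᶠ φ)  = eval k ψ ∧ eval k φ

_⊨_ : ∀ {n} → Config n → FeatExp n → Set
k ⊨ ψ = eval k ψ ≡ true

-- ψ[l_A ↦ c]: put ψ in negation normal form (tracking polarity p) and replace
-- both literals of A by the constant c; remaining features are renamed into
-- 𝔽 ∖ {A} (represented by Fin m via punchOut).
const : ∀ {m} → Bool → FeatExp m
const true  = tt
const false = ff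

substLit : ∀ {m} → Fin (suc m) → Bool → Bool → FeatExp (suc m) → FeatExp m
substLit A c p tt       = const p
substLit A c p (var B) with A ≟ B
... | yes _  = const c
... | no A≢B = if p then var (punchOut A≢B) else (¬ᶠ var (punchOut A≢B))
substLit A c p (¬ᶠ ψ)   = substLit A c (not p) ψ
substLit A c p (ψ ∧ᶠ φ) =
  if p then (substLit A c p ψ ∧ᶠ substLit A c p φ)
       else (substLit A c p ψ ∨ᶠ substLit A c p φ)

_[_↦_] : ∀ {m} → FeatExp (suc m) → Fin (suc m) → Bool → FeatExp m
ψ [ A ↦ c ] = substLit A c true ψ

data Abs : ℕ → ℕ → Set where
  join    : ∀ {n} → Abs n 0
  fignore : ∀ {m} → (A : Fin (suc m)) → Abs (suc m) m

αConf : ∀ {n m} → Abs n m → Config n → Config m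
αConf join        k = []
αConf (fignore A) k = removeAt k A

αConfs : ∀ {n m} → Abs n m → List (Config n) → List (Config m)
αConfs join        K = [] ∷ []            -- {true}
αConfs (fignore A) K = map (αConf (fignore A)) K

αExp : ∀ {n m} → Abs n m → List (Config n) → FeatExp n → FeatExp m
αExp join        K ψ = if any (λ k → eval k ψ) K then tt else ff
αExp (fignore A) K ψ = ψ [ A ↦ true ]

αExpDual : ∀ {n m} → Abs n m → List (Config n) → FeatExp n → FeatExp m
αExpDual α K ψ = ¬ᶠ (αExp α K (¬ᶠ ψ))

-- Both abstractions are sound for satisfaction: if k ∈ 𝒦 and k ⊨ ψ then α(k) ⊨ α(ψ).
-- For the join this is the existential reading of α(ψ); for ignoring A it holds
-- because replacing both literals of A by true only weakens the negation normal
-- form of ψ. Part (i) takes α(k) as the witness, and part (ii) is soundness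
-- applied to ¬ψ, since α̃(ψ) = ¬ α(¬ψ).
module Submission where

open import Defs
open import Data.Nat using (ℕ; suc)
open import Data.Bool using (Bool; true; false; not; _∧_)
  renaming (_≟_ to _≟ᵇ_)
open import Data.Bool.Properties using (T-≡; not-involutive)
open import Data.Bool.ListAction using (any)
open import Data.Fin using (Fin; _≟_)
open import Data.Vec using (removeAt)
open import Data.Vec.Properties using (removeAt-punchOut)
open import Data.List using (List; [])
open import Data.List.Membership.Propositional using (_∈_; lose)
open import Data.List.Membership.Propositional.Properties using (∈-map⁺)
open import Data.List.Relation.Unary.Any using (here)
open import Data.List.Relation.Unary.Any.Properties using (any⁺)
open import Data.Product using (_×_; ∃-syntax; _,_)
open import Data.Empty using (⊥-elim)
open import Function.Bundles using (Equivalence)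
open import Relation.Nullary using (¬_; yes; no)
open import Relation.Nullary.Decidable using (decidable-stable)
open import Relation.Binary.PropositionalEquality using (_≡_; _≢_; refl; sym; trans; cong; cong₂)

any-complete : ∀ {A : Set} (p : A → Bool) {x xs} → x ∈ xs → p x ≡ true → any p xs ≡ true
any-complete p x∈xs px = Equivalence.to T-≡ (any⁺ p (lose x∈xs (Equivalence.from T-≡ px)))

module _ {n : ℕ} {k : Config n} where

  ⊭⇒⊨¬ᶠ : {ψ : FeatExp n} → ¬ (k ⊨ ψ) → k ⊨ (¬ᶠ ψ)
  ⊭⇒⊨¬ᶠ {ψ} with eval k ψ
  ... | true  = λ k⊭ψ → ⊥-elim (k⊭ψ refl)
  ... | false = λ _ → refl

  ⊨¬ᶠ⇒⊭ : {ψ : FeatExp n} → k ⊨ (¬ᶠ ψ) → ¬ (k ⊨ ψ)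
  ⊨¬ᶠ⇒⊭ {ψ} with eval k ψ
  ... | true  = λ ()
  ... | false = λ _ ()

  ∨ᶠ-introˡ : (ψ φ : FeatExp n) → k ⊨ ψ → k ⊨ (ψ ∨ᶠ φ)
  ∨ᶠ-introˡ ψ φ k⊨ψ rewrite k⊨ψ = refl

  ∨ᶠ-introʳ : (ψ φ : FeatExp n) → k ⊨ φ → k ⊨ (ψ ∨ᶠ φ)
  ∨ᶠ-introʳ ψ φ k⊨φ with eval k ψ
  ... | true  = refl
  ... | false rewrite k⊨φ = refl

-- Polarity p records whether ψ occurs positively; the claim for p = false is what
-- makes the induction pass through negation.
substLit-true-sound : ∀ {m} (A : Fin (suc m)) (k : Config (suc m)) (p : Bool) (ψ : FeatExp (suc m)) →
                      eval k ψ ≡ p → removeAt k A ⊨ substLit A true p ψ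
substLit-true-sound A k p tt refl = refl
substLit-true-sound A k p (var B) kB≡p with A ≟ B
... | yes _ = refl
substLit-true-sound A k true  (var B) kB≡p | no A≢B = trans (removeAt-punchOut k A≢B) kB≡p
substLit-true-sound A k false (var B) kB≡p | no A≢B = cong not (trans (removeAt-punchOut k A≢B) kB≡p)
substLit-true-sound A k p (¬ᶠ ψ) kψ≡¬p =
  substLit-true-sound A k (not p) ψ (trans (sym (not-involutive _)) (cong not kψ≡¬p))
substLit-true-sound A k true (ψ ∧ᶠ φ) kψ∧φ with eval k ψ in kψ
... | true = cong₂ _∧_ (substLit-true-sound A k true ψ kψ) (substLit-true-sound A k true φ kψ∧φ)
substLit-true-sound A k false (ψ ∧ᶠ φ) kψ∧φ with eval k ψ in kψ
... | false = ∨ᶠ-introˡ (substLit A true false ψ) (substLit A true false φ) (substLit-true-sound A k false ψ kψ)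
... | true  = ∨ᶠ-introʳ (substLit A true false ψ) (substLit A true false φ) (substLit-true-sound A k false φ kψ∧φ)

αConf-∈ : ∀ {n m} (α : Abs n m) {K : List (Config n)} {k : Config n} → k ∈ K → αConf α k ∈ αConfs α K
αConf-∈ join        _   = here refl
αConf-∈ (fignore A) k∈K = ∈-map⁺ (λ k → removeAt k A) k∈K

αExp-sound : ∀ {n m} (α : Abs n m) {K : List (Config n)} {k : Config n} {ψ : FeatExp n} →
             k ∈ K → k ⊨ ψ → αConf α k ⊨ αExp α K ψ
αExp-sound join {ψ = ψ} k∈K k⊨ψ rewrite any-complete (λ k → eval k ψ) k∈K k⊨ψ = refl
αExp-sound (fignore A) {k = k} {ψ} _ k⊨ψ = substLit-true-sound A k true ψ k⊨ψ

lemma1 : ∀ {n m} (K : List (Config n)) → K ≢ [] →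
         (ψ : FeatExp n) (α : Abs n m) →
         (∀ (k : Config n) → k ∈ K → k ⊨ ψ →
            ∃[ k' ] (k' ∈ αConfs α K × k' ⊨ αExp α K ψ))
         × (∀ (k' : Config m) → k' ∈ αConfs α K → k' ⊨ αExpDual α K ψ →
            ∀ (k : Config n) → k ∈ K → αConf α k ≡ k' → k ⊨ ψ)
lemma1 K _ ψ α = existential , universal
  where
  existential : ∀ k → k ∈ K → k ⊨ ψ → ∃[ k' ] (k' ∈ αConfs α K × k' ⊨ αExp α K ψ)
  existential k k∈K k⊨ψ = αConf α k , αConf-∈ α k∈K , αExp-sound α k∈K k⊨ψ

  universal : ∀ k' → k' ∈ αConfs α K → k' ⊨ αExpDual α K ψ →
              ∀ k → k ∈ K → αConf α k ≡ k' → k ⊨ ψ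
  universal _ _ k'⊨α̃ψ k k∈K refl = decidable-stable (eval k ψ ≟ᵇ true) λ k⊭ψ →
    ⊨¬ᶠ⇒⊭ {ψ = αExp α K (¬ᶠ ψ)} k'⊨α̃ψ (αExp-sound α k∈K (⊭⇒⊨¬ᶠ {ψ = ψ} k⊭ψ))
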